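{- Let $H$ be an $r$-graph. If $H$ contains a $2$-locally large subgraph, then $H$ is $2$-locally large.
   Context: An $r$-graph is an $r$-uniform hypergraph. Let $H$ be an $r$-graph on $h$ vertices and $\sigma:V(H)\to[h]$ a bijection. For a vertex $x$ and $1\le i\le r$, let $T_x^i$ be the set of edges $e\ni x$ such that $x$ is the $i$-th element of $e$ when the vertices of $e$ are listed in increasing order of $\sigma$; for $r+1\le i\le 2r+1$, let $T_x^i$ be the set of edges $e\not\ni x$ such that $x$ is the $(i-r)$-th element of $e\cup\{x\}$ when listed in increasing order of $\sigma$. $H$ is 2-locally large if there is a bijection $\sigma$ such that for every vertex $x\in V(H)$ some $T_x^i$, $i\in[2r+1]$, contains at least two edges. -}

module Defs where

open import Data.Nat using (ℕ; _+_; _*_; _∸_; _≤_; _<?_)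
open import Data.Fin using (Fin; toℕ)
open import Data.Fin.Subset using (Subset; _∈_; _∉_; _⊆_; _∩_; ∣_∣; Nonempty)
open import Data.Vec using (tabulate)
open import Data.Product using (Σ; ∃; ∃-syntax; _×_)
open import Data.Sum using (_⊎_)
open import Relation.Binary.PropositionalEquality using (_≡_; _≢_)
open import Relation.Nullary.Decidable using (⌊_⌋)

record RGraph (r n : ℕ) : Set₁ where
  field
    V       : Subset n
    E       : Subset n → Set
    uniform : ∀ e → E e → ∣ e ∣ ≡ r
    inV     : ∀ e → E e → e ⊆ V
open RGraph public

record Subgraph {r n : ℕ} (H' H : RGraph r n) : Set where
  field
    V⊆ : V H' ⊆ V H
    E⊆ : ∀ e → E H' e → E H e

-- σ : V(H) → [h] is a bijection, with h = |V(H)|.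
-- (ranks are Fin h, i.e. 0,…,h-1 instead of 1,…,h)
IsBijectionOn : ∀ {n} (V : Subset n) → (Fin n → Fin ∣ V ∣) → Set
IsBijectionOn {n} V σ =
  (∀ x y → x ∈ V → y ∈ V → σ x ≡ σ y → x ≡ y) ×
  (∀ (k : Fin ∣ V ∣) → ∃[ x ] (x ∈ V × σ x ≡ k))

below : ∀ {n h} → (Fin n → Fin h) → Subset n → Fin n → ℕ
below σ e x = ∣ e ∩ tabulate (λ y → ⌊ toℕ (σ y) <? toℕ (σ x) ⌋) ∣

InT : ∀ {n h} (r : ℕ) → (Fin n → Fin h) → Fin n → ℕ → Subset n → Set
InT r σ x i e =
  (1 ≤ i × i ≤ r × x ∈ e × below σ e x + 1 ≡ i)
  ⊎ (r + 1 ≤ i × i ≤ 2 * r + 1 × x ∉ e × below σ e x + 1 ≡ i ∸ r)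

TwoLocallyLarge : ∀ {r n} → RGraph r n → Set
TwoLocallyLarge {r} H =
  Σ (Fin _ → Fin ∣ V H ∣) λ σ → IsBijectionOn (V H) σ ×
    (∀ x → x ∈ V H →
      ∃[ i ] (1 ≤ i × i ≤ 2 * r + 1 ×
        ∃[ e ] ∃[ e' ] (e ≢ e' × E H e × E H e' × InT r σ x i e × InT r σ x i e')))

{-# OPTIONS --safe #-}

-- Take an ordering τ witnessing that H′ is 2-locally large and extend it to V(H) by
-- listing V(H′) first, in the order of τ, and the remaining vertices after it.  A vertex
-- of H′ sees every edge of H′ exactly as under τ, so its two edges in a common T_x^i
-- survive.  A vertex outside H′ comes after all of V(H′), so every edge of H′ lies in
-- its T_x^{2r+1}, and H′ has two distinct edges because it is large at some vertex.
-- The extended ordering is the rank function of the key "τ on V(H′), then |V(H′)| + x".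

module Submission where

open import Defs
open import Data.Fin as Fin using (Fin; toℕ; _↑ˡ_; _↑ʳ_)
open import Data.Fin.Properties
  using (toℕ-injective; toℕ<n; toℕ-fromℕ<; toℕ-↑ˡ; toℕ-↑ʳ; ↑ˡ-injective; ↑ʳ-injective; any?)
open import Data.Fin.Subset using (Subset; inside; outside; _∈_; _∉_; _⊆_; _∩_; _∪_; ⁅_⁆; ∣_∣; ⊥; Nonempty)
open import Data.Fin.Subset.Properties
  using (_∈?_; x∈p∩q⁺; x∈p∩q⁻; x∈p∪q⁺; x∈⁅x⁆; ∣p∣≤∣x∷p∣; ∣p∩q∣≤∣p∣; ∣⁅x⁆∣≡1; ∣⊥∣≡0; p⊆q⇒∣p∣≤∣q∣; p⊂q⇒∣p∣<∣q∣)
open import Data.Nat using (ℕ; suc; _+_; _*_; _∸_; _≤_; _<_; z≤n; s≤s; NonZero; >-nonZero)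
open import Data.Nat.DivMod using (_mod_; m<n⇒m%n≡m)
open import Data.Nat.Properties
open import Data.Bool.Properties using (T-≡)
open import Data.Product using (∃-syntax; _×_; _,_; proj₂)
open import Data.Sum as Sum using (_⊎_; inj₁; inj₂)
open import Data.Vec using (_∷_; []; tabulate)
open import Data.Vec.Properties using (lookup∘tabulate; lookup⇒[]=; []=⇒lookup)
open import Function using (id; _⇔_; mk⇔; Equivalence)
open import Function.Construct.Composition using (_⇔-∘_)
open import Function.Construct.Identity using (⇔-id)
open import Function.Construct.Symmetry using (⇔-sym)
open import Function.Definitions using (Injective)
open import Relation.Binary using (tri<; tri≈; tri>)
open import Relation.Binary.PropositionalEquality
  using (_≡_; _≢_; refl; sym; trans; cong; subst; subst₂; module ≡-Reasoning)
open import Relation.Nullary using (yes; no; contradiction)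
open import Relation.Nullary.Decidable using (⌊_⌋; toWitness; fromWitness; _×-dec_)
open import Relation.Unary using (Decidable)

open Equivalence

InjectiveOn : ∀ {n} {A : Set} → Subset n → (Fin n → A) → Set
InjectiveOn V f = ∀ x y → x ∈ V → y ∈ V → f x ≡ f y → x ≡ y

crossing : (g : ℕ → ℕ) (B : ℕ) {k : ℕ} → g 0 ≤ k → k < g B →
           ∃[ t ] (g t ≤ k × k < g (suc t))
crossing g 0 g0≤k k<g0 = contradiction g0≤k (<⇒≱ k<g0)
crossing g (suc B) g0≤k k<gB+1 with _ <? g B
... | yes k<gB = crossing g B g0≤k k<gB
... | no k≮gB = B , ≮⇒≥ k≮gB , k<gB+1

∣p∪q∣≤∣p∣+∣q∣ : ∀ {n} (p q : Subset n) → ∣ p ∪ q ∣ ≤ ∣ p ∣ + ∣ q ∣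
∣p∪q∣≤∣p∣+∣q∣ []            []            = z≤n
∣p∪q∣≤∣p∣+∣q∣ (inside ∷ p)  (s ∷ q)       =
  s≤s (≤-trans (∣p∪q∣≤∣p∣+∣q∣ p q) (+-monoʳ-≤ ∣ p ∣ (∣p∣≤∣x∷p∣ s q)))
∣p∪q∣≤∣p∣+∣q∣ (outside ∷ p) (inside ∷ q)  =
  ≤-trans (s≤s (∣p∪q∣≤∣p∣+∣q∣ p q)) (≤-reflexive (sym (+-suc ∣ p ∣ ∣ q ∣)))
∣p∪q∣≤∣p∣+∣q∣ (outside ∷ p) (outside ∷ q) = ∣p∪q∣≤∣p∣+∣q∣ p q

p∩q⊆p∩r : ∀ {n} (p q r : Subset n) → (∀ {x} → x ∈ p → x ∈ q → x ∈ r) → p ∩ q ⊆ p ∩ r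
p∩q⊆p∩r p q r q⊆r x∈p∩q with x∈p , x∈q ← x∈p∩q⁻ p q x∈p∩q = x∈p∩q⁺ (x∈p , q⊆r x∈p x∈q)

∣p∩q∣≡∣p∩r∣ : ∀ {n} (p q r : Subset n) → (∀ {x} → x ∈ p → x ∈ q ⇔ x ∈ r) →
              ∣ p ∩ q ∣ ≡ ∣ p ∩ r ∣
∣p∩q∣≡∣p∩r∣ p q r q⇔r = ≤-antisym
  (p⊆q⇒∣p∣≤∣q∣ (p∩q⊆p∩r p q r (λ x∈p → to (q⇔r x∈p))))
  (p⊆q⇒∣p∣≤∣q∣ (p∩q⊆p∩r p r q (λ x∈p → from (q⇔r x∈p))))

p⊆q⇒∣p∩q∣≡∣p∣ : ∀ {n} {p q : Subset n} → p ⊆ q → ∣ p ∩ q ∣ ≡ ∣ p ∣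
p⊆q⇒∣p∩q∣≡∣p∣ {p = p} {q} p⊆q =
  ≤-antisym (∣p∩q∣≤∣p∣ p q) (p⊆q⇒∣p∣≤∣q∣ (λ x∈p → x∈p∩q⁺ (x∈p , p⊆q x∈p)))

∈-tabulate⇔ : ∀ {n} {P : Fin n → Set} (P? : Decidable P) {y : Fin n} →
              y ∈ tabulate (λ z → ⌊ P? z ⌋) ⇔ P y
∈-tabulate⇔ P? {y} = mk⇔
  (λ y∈ → toWitness (from T-≡ (trans (sym (lookup∘tabulate _ y)) ([]=⇒lookup y∈))))
  (λ Py → lookup⇒[]= y _ (trans (lookup∘tabulate _ y) (to T-≡ (fromWitness Py))))

module Rank {n m} (V : Subset n) (key : Fin n → Fin m) (key-injective : InjectiveOn V key) where

  keyBelow : ℕ → Subset n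
  keyBelow t = tabulate (λ y → ⌊ toℕ (key y) <? t ⌋)

  ∈keyBelow⇔ : ∀ {y t} → y ∈ keyBelow t ⇔ toℕ (key y) < t
  ∈keyBelow⇔ {t = t} = ∈-tabulate⇔ (λ y → toℕ (key y) <? t)

  count : ℕ → ℕ
  count t = ∣ V ∩ keyBelow t ∣

  rank : Fin n → ℕ
  rank x = count (toℕ (key x))

  count-mono : ∀ {t u} → t ≤ u → count t ≤ count u
  count-mono t≤u = p⊆q⇒∣p∣≤∣q∣ (p∩q⊆p∩r V (keyBelow _) (keyBelow _)
    (λ _ y∈ → from ∈keyBelow⇔ (<-≤-trans (to ∈keyBelow⇔ y∈) t≤u)))

  count-strict : ∀ {x t u} → x ∈ V → t ≤ toℕ (key x) → toℕ (key x) < u → count t < count u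
  count-strict {x} {t} {u} x∈V t≤kx kx<u =
    p⊂q⇒∣p∣<∣q∣ (⊆ , x , x∈p∩q⁺ (x∈V , from ∈keyBelow⇔ kx<u) , x∉)
    where
    ⊆ : V ∩ keyBelow t ⊆ V ∩ keyBelow u
    ⊆ = p∩q⊆p∩r V (keyBelow t) (keyBelow u)
          (λ _ y∈ → from ∈keyBelow⇔ (<-trans (<-≤-trans (to ∈keyBelow⇔ y∈) t≤kx) kx<u))
    x∉ : x ∉ V ∩ keyBelow t
    x∉ x∈ = <⇒≱ (to ∈keyBelow⇔ (proj₂ (x∈p∩q⁻ V (keyBelow t) x∈))) t≤kx

  count-zero : count 0 ≡ 0
  count-zero = n≤0⇒n≡0 (≤-trans (p⊆q⇒∣p∣≤∣q∣ ⊆⊥) (≤-reflexive (∣⊥∣≡0 n)))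
    where
    ⊆⊥ : V ∩ keyBelow 0 ⊆ ⊥
    ⊆⊥ y∈ = contradiction (to ∈keyBelow⇔ (proj₂ (x∈p∩q⁻ V (keyBelow 0) y∈))) n≮0

  count-all : count m ≡ ∣ V ∣
  count-all =
    p⊆q⇒∣p∩q∣≡∣p∣ {p = V} {q = keyBelow m} (λ {y} _ → from ∈keyBelow⇔ (toℕ<n (key y)))

  keyBelow-suc : ∀ {y t} → y ∈ keyBelow (suc t) → y ∈ keyBelow t ⊎ toℕ (key y) ≡ t
  keyBelow-suc y∈ = Sum.map₁ (from ∈keyBelow⇔) (m≤n⇒m<n∨m≡n (m<1+n⇒m≤n (to ∈keyBelow⇔ y∈)))

  count-flat : ∀ {t} → (∀ {y} → y ∈ V → toℕ (key y) ≢ t) → count (suc t) ≤ count t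
  count-flat {t} no-key-t = p⊆q⇒∣p∣≤∣q∣ (p∩q⊆p∩r V (keyBelow (suc t)) (keyBelow t) below-t)
    where
    below-t : ∀ {y} → y ∈ V → y ∈ keyBelow (suc t) → y ∈ keyBelow t
    below-t y∈V y∈ = Sum.[ id , (λ ky≡t → contradiction ky≡t (no-key-t y∈V)) ] (keyBelow-suc y∈)

  count-jump : ∀ {t} → count t < count (suc t) → ∃[ y ] (y ∈ V × toℕ (key y) ≡ t)
  count-jump {t} grows with any? (λ (y : Fin n) → (y ∈? V) ×-dec (toℕ (key y) ≟ t))
  ... | yes found = found
  ... | no ∄y = contradiction (count-flat (λ y∈V ky≡t → ∄y (_ , y∈V , ky≡t))) (<⇒≱ grows)

  count-step : ∀ {y} → y ∈ V → count (suc (toℕ (key y))) ≤ suc (rank y)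
  count-step {y} y∈V = begin
    count (suc (toℕ (key y)))                 ≤⟨ p⊆q⇒∣p∣≤∣q∣ ⊆∪ ⟩
    ∣ (V ∩ keyBelow (toℕ (key y))) ∪ ⁅ y ⁆ ∣  ≤⟨ ∣p∪q∣≤∣p∣+∣q∣ (V ∩ keyBelow (toℕ (key y))) ⁅ y ⁆ ⟩
    rank y + ∣ ⁅ y ⁆ ∣                        ≡⟨ cong (rank y +_) (∣⁅x⁆∣≡1 y) ⟩
    rank y + 1                                ≡⟨ +-comm (rank y) 1 ⟩
    suc (rank y)                              ∎
    where
    open ≤-Reasoning
    ⊆∪ : V ∩ keyBelow (suc (toℕ (key y))) ⊆ (V ∩ keyBelow (toℕ (key y))) ∪ ⁅ y ⁆
    ⊆∪ {z} z∈ with z∈V , z∈′ ← x∈p∩q⁻ V _ z∈ =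
      x∈p∪q⁺ (Sum.map (λ z∈″ → x∈p∩q⁺ (z∈V , z∈″)) same-key (keyBelow-suc z∈′))
      where
      same-key : toℕ (key z) ≡ toℕ (key y) → z ∈ ⁅ y ⁆
      same-key kz≡ky =
        subst (_∈ ⁅ y ⁆) (sym (key-injective z y z∈V y∈V (toℕ-injective kz≡ky))) (x∈⁅x⁆ y)

  rank<∣V∣ : ∀ {x} → x ∈ V → rank x < ∣ V ∣
  rank<∣V∣ {x} x∈V = <-≤-trans (count-strict x∈V ≤-refl (toℕ<n (key x))) (≤-reflexive count-all)

  -- count climbs from 0 to ∣ V ∣ in unit steps; at the step where it passes k, the
  -- vertex carrying that key has rank exactly k.
  rank-surjective : ∀ {k} → k < ∣ V ∣ → ∃[ y ] (y ∈ V × rank y ≡ k)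
  rank-surjective {k} k<∣V∣
    with t , count-t≤k , k<count-t+1 ← crossing count m (≤-trans (≤-reflexive count-zero) z≤n)
                                                         (<-≤-trans k<∣V∣ (≤-reflexive (sym count-all)))
    with y , y∈V , refl ← count-jump (≤-<-trans count-t≤k k<count-t+1)
    = y , y∈V , ≤-antisym count-t≤k (m<1+n⇒m≤n (<-≤-trans k<count-t+1 (count-step y∈V)))

  rank-<⇔ : ∀ {x y} → x ∈ V → y ∈ V → toℕ (key y) < toℕ (key x) ⇔ rank y < rank x
  rank-<⇔ x∈V y∈V = mk⇔
    (λ ky<kx → count-strict y∈V ≤-refl ky<kx)
    (λ ry<rx → ≰⇒> (λ kx≤ky → <⇒≱ ry<rx (count-mono kx≤ky)))

  rank-injective : InjectiveOn V rank
  rank-injective x y x∈V y∈V rx≡ry with <-cmp (toℕ (key x)) (toℕ (key y))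
  ... | tri< kx<ky _ _ = contradiction rx≡ry (<⇒≢ (to (rank-<⇔ y∈V x∈V) kx<ky))
  ... | tri≈ _ kx≡ky _ = key-injective x y x∈V y∈V (toℕ-injective kx≡ky)
  ... | tri> _ _ ky<kx = contradiction (sym rx≡ry) (<⇒≢ (to (rank-<⇔ x∈V y∈V) ky<kx))

rank-ordering : ∀ {n m} (V : Subset n) → Nonempty V → (key : Fin n → Fin m) → InjectiveOn V key →
  ∃[ σ ] (IsBijectionOn V σ × (∀ {x y} → x ∈ V → y ∈ V → key y Fin.< key x ⇔ σ y Fin.< σ x))
rank-ordering {n} V (v , v∈V) key key-injective = σ , (σ-injective , σ-surjective) , σ-<⇔
  where
  open Rank V key key-injective

  instance
    ∣V∣-nonZero : NonZero ∣ V ∣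
    ∣V∣-nonZero = >-nonZero (m<n⇒0<n (rank<∣V∣ v∈V))

  -- rank x < ∣ V ∣ on V, so the reduction only changes the junk values off V.
  σ : Fin n → Fin ∣ V ∣
  σ x = rank x mod ∣ V ∣

  toℕ-σ : ∀ {x} → x ∈ V → toℕ (σ x) ≡ rank x
  toℕ-σ x∈V = trans (toℕ-fromℕ< _) (m<n⇒m%n≡m (rank<∣V∣ x∈V))

  σ-injective : InjectiveOn V σ
  σ-injective x y x∈V y∈V σx≡σy =
    rank-injective x y x∈V y∈V (trans (sym (toℕ-σ x∈V)) (trans (cong toℕ σx≡σy) (toℕ-σ y∈V)))

  σ-surjective : ∀ k → ∃[ x ] (x ∈ V × σ x ≡ k)
  σ-surjective k with x , x∈V , rx≡k ← rank-surjective (toℕ<n k) =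
    x , x∈V , toℕ-injective (trans (toℕ-σ x∈V) rx≡k)

  σ-<⇔ : ∀ {x y} → x ∈ V → y ∈ V → key y Fin.< key x ⇔ σ y Fin.< σ x
  σ-<⇔ {x} {y} x∈V y∈V =
    subst₂ (λ a b → key y Fin.< key x ⇔ a < b) (sym (toℕ-σ y∈V)) (sym (toℕ-σ x∈V))
           (rank-<⇔ x∈V y∈V)

↑ˡ≢↑ʳ : ∀ {m n} (i : Fin m) (j : Fin n) → i ↑ˡ n ≢ m ↑ʳ j
↑ˡ≢↑ʳ {m} {n} i j i↑ˡn≡m↑ʳj = <⇒≢ (<-≤-trans (toℕ<n i) (m≤m+n m (toℕ j))) (begin
  toℕ i         ≡⟨ toℕ-↑ˡ i n ⟨
  toℕ (i ↑ˡ n)  ≡⟨ cong toℕ i↑ˡn≡m↑ʳj ⟩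
  toℕ (m ↑ʳ j)  ≡⟨ toℕ-↑ʳ m j ⟩
  m + toℕ j     ∎)
  where open ≡-Reasoning

module _ {n m} (V′ : Subset n) (τ : Fin n → Fin m) where

  prefixKey : Fin n → Fin (m + n)
  prefixKey x with x ∈? V′
  ... | yes _ = τ x ↑ˡ n
  ... | no _  = m ↑ʳ x

  toℕ-prefixKey-∈ : ∀ {x} → x ∈ V′ → toℕ (prefixKey x) ≡ toℕ (τ x)
  toℕ-prefixKey-∈ {x} x∈V′ with x ∈? V′
  ... | yes _    = toℕ-↑ˡ (τ x) n
  ... | no x∉V′ = contradiction x∈V′ x∉V′

  toℕ-prefixKey-∉ : ∀ {x} → x ∉ V′ → toℕ (prefixKey x) ≡ m + toℕ x
  toℕ-prefixKey-∉ {x} x∉V′ with x ∈? V′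
  ... | yes x∈V′ = contradiction x∈V′ x∉V′
  ... | no _     = toℕ-↑ʳ m x

  prefixKey-<⇔ : ∀ {x y} → x ∈ V′ → y ∈ V′ → τ y Fin.< τ x ⇔ prefixKey y Fin.< prefixKey x
  prefixKey-<⇔ {x} {y} x∈V′ y∈V′ =
    subst₂ (λ a b → τ y Fin.< τ x ⇔ a < b) (sym (toℕ-prefixKey-∈ y∈V′)) (sym (toℕ-prefixKey-∈ x∈V′))
           (⇔-id _)

  prefixKey-∈<∉ : ∀ {x y} → y ∈ V′ → x ∉ V′ → prefixKey y Fin.< prefixKey x
  prefixKey-∈<∉ {x} {y} y∈V′ x∉V′ = begin-strict
    toℕ (prefixKey y) ≡⟨ toℕ-prefixKey-∈ y∈V′ ⟩
    toℕ (τ y)         <⟨ toℕ<n (τ y) ⟩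
    m                 ≤⟨ m≤m+n m (toℕ x) ⟩
    m + toℕ x         ≡⟨ toℕ-prefixKey-∉ x∉V′ ⟨
    toℕ (prefixKey x) ∎
    where open ≤-Reasoning

  prefixKey-injective : InjectiveOn V′ τ → Injective _≡_ _≡_ prefixKey
  prefixKey-injective τ-injective {x} {y} kx≡ky with x ∈? V′ | y ∈? V′
  ... | yes x∈V′ | yes y∈V′ = τ-injective x y x∈V′ y∈V′ (↑ˡ-injective n (τ x) (τ y) kx≡ky)
  ... | no _     | no _     = ↑ʳ-injective m x y kx≡ky
  ... | yes _    | no _     = contradiction kx≡ky (↑ˡ≢↑ʳ (τ x) y)
  ... | no _     | yes _    = contradiction (sym kx≡ky) (↑ˡ≢↑ʳ (τ y) x)

ordering-extension : ∀ {n m} {V V′ : Subset n} → V′ ⊆ V → Nonempty V →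
  (τ : Fin n → Fin m) → InjectiveOn V′ τ →
  ∃[ σ ] (IsBijectionOn V σ
         × (∀ {x y} → x ∈ V′ → y ∈ V′ → τ y Fin.< τ x ⇔ σ y Fin.< σ x)
         × (∀ {x y} → x ∈ V → x ∉ V′ → y ∈ V′ → σ y Fin.< σ x))
ordering-extension {V = V} {V′} V′⊆V nonempty τ τ-injective =
  let σ , σ-bijective , σ-<⇔ = rank-ordering V nonempty (prefixKey V′ τ)
                                 (λ _ _ _ _ → prefixKey-injective V′ τ τ-injective)
  in σ , σ-bijective
       , (λ x∈V′ y∈V′ → σ-<⇔ (V′⊆V x∈V′) (V′⊆V y∈V′) ⇔-∘ prefixKey-<⇔ V′ τ x∈V′ y∈V′)
       , (λ x∈V x∉V′ y∈V′ → to (σ-<⇔ x∈V (V′⊆V y∈V′)) (prefixKey-∈<∉ V′ τ y∈V′ x∉V′))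

precedes : ∀ {n h} → (Fin n → Fin h) → Fin n → Subset n
precedes σ x = tabulate (λ y → ⌊ toℕ (σ y) <? toℕ (σ x) ⌋)

∈precedes⇔ : ∀ {n h} (σ : Fin n → Fin h) (x : Fin n) {y : Fin n} →
             y ∈ precedes σ x ⇔ σ y Fin.< σ x
∈precedes⇔ σ x = ∈-tabulate⇔ (λ z → toℕ (σ z) <? toℕ (σ x))

below-cong : ∀ {n h h′} (σ : Fin n → Fin h) (τ : Fin n → Fin h′) {e : Subset n} {x : Fin n} →
             (∀ {y} → y ∈ e → σ y Fin.< σ x ⇔ τ y Fin.< τ x) → below σ e x ≡ below τ e x
below-cong σ τ {e} {x} σ⇔τ = ∣p∩q∣≡∣p∩r∣ e (precedes σ x) (precedes τ x)
  (λ y∈e → ⇔-sym (∈precedes⇔ τ x) ⇔-∘ (σ⇔τ y∈e ⇔-∘ ∈precedes⇔ σ x))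

below-max : ∀ {n h} (σ : Fin n → Fin h) {e : Subset n} {x : Fin n} →
            (∀ {y} → y ∈ e → σ y Fin.< σ x) → below σ e x ≡ ∣ e ∣
below-max σ {e} {x} e<x =
  p⊆q⇒∣p∩q∣≡∣p∣ {p = e} {q = precedes σ x} (λ y∈e → from (∈precedes⇔ σ x) (e<x y∈e))

InT-cong : ∀ {n h h′ r i} {σ : Fin n → Fin h} {τ : Fin n → Fin h′} {x e} →
           below σ e x ≡ below τ e x → InT r σ x i e → InT r τ x i e
InT-cong σ≡τ (inj₁ (1≤i , i≤r , x∈e , pos)) =
  inj₁ (1≤i , i≤r , x∈e , trans (cong (_+ 1) (sym σ≡τ)) pos)
InT-cong σ≡τ (inj₂ (r<i , i≤2r+1 , x∉e , pos)) =
  inj₂ (r<i , i≤2r+1 , x∉e , trans (cong (_+ 1) (sym σ≡τ)) pos)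

[2r+1]∸r≡r+1 : ∀ r → 2 * r + 1 ∸ r ≡ r + 1
[2r+1]∸r≡r+1 r = begin
  2 * r + 1 ∸ r       ≡⟨ cong (λ k → k + 1 ∸ r) (cong (r +_) (+-identityʳ r)) ⟩
  r + r + 1 ∸ r       ≡⟨ cong (_∸ r) (+-assoc r r 1) ⟩
  r + (r + 1) ∸ r     ≡⟨ m+n∸m≡n r (r + 1) ⟩
  r + 1               ∎
  where open ≡-Reasoning

InT-last : ∀ {n h r} {σ : Fin n → Fin h} {x e} →
           ∣ e ∣ ≡ r → x ∉ e → (∀ {y} → y ∈ e → σ y Fin.< σ x) → InT r σ x (2 * r + 1) e
InT-last {r = r} {σ} ∣e∣≡r x∉e e<x = inj₂
  ( +-monoˡ-≤ 1 (m≤m+n r (r + 0)) , ≤-refl , x∉e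
  , trans (cong (_+ 1) (trans (below-max σ e<x) ∣e∣≡r)) (sym ([2r+1]∸r≡r+1 r)))

LargeAt : ∀ {n h} (r : ℕ) → (Subset n → Set) → (Fin n → Fin h) → Fin n → Set
LargeAt r E σ x = ∃[ i ] (1 ≤ i × i ≤ 2 * r + 1 ×
  ∃[ e ] ∃[ e′ ] (e ≢ e′ × E e × E e′ × InT r σ x i e × InT r σ x i e′))

module _ {n h h′ r : ℕ} {E F : Subset n → Set} {τ : Fin n → Fin h′} {σ : Fin n → Fin h}
         (E⊆F : ∀ e → E e → F e) where

  LargeAt-map : ∀ {x} → (∀ {i e} → E e → InT r τ x i e → InT r σ x i e) →
                LargeAt r E τ x → LargeAt r F σ x
  LargeAt-map move (i , 1≤i , i≤2r+1 , e , e′ , e≢e′ , Ee , Ee′ , Te , Te′) =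
    i , 1≤i , i≤2r+1 , e , e′ , e≢e′ , E⊆F e Ee , E⊆F e′ Ee′ , move Ee Te , move Ee′ Te′

  LargeAt-top : ∀ {x v} → (∀ {e} → E e → InT r σ x (2 * r + 1) e) →
                LargeAt r E τ v → LargeAt r F σ x
  LargeAt-top top (_ , _ , _ , e , e′ , e≢e′ , Ee , Ee′ , _) =
    2 * r + 1 , m≤n+m 1 (2 * r) , ≤-refl , e , e′ , e≢e′ , E⊆F e Ee , E⊆F e′ Ee′ , top Ee , top Ee′

large-transfer : ∀ {r n h h′} {H′ H : RGraph r n} {τ : Fin n → Fin h′} {σ : Fin n → Fin h} →
  Subgraph H′ H →
  (∀ {x y} → x ∈ V H′ → y ∈ V H′ → τ y Fin.< τ x ⇔ σ y Fin.< σ x) →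
  (∀ {x y} → x ∈ V H → x ∉ V H′ → y ∈ V H′ → σ y Fin.< σ x) →
  Nonempty (V H′) → (∀ x → x ∈ V H′ → LargeAt r (E H′) τ x) →
  ∀ x → x ∈ V H → LargeAt r (E H) σ x
large-transfer {H′ = H′} {τ = τ} {σ} H′⊆H τ⇔σ V′-first (v , v∈V′) H′-large x x∈V
  with x ∈? V H′
... | yes x∈V′ = LargeAt-map (Subgraph.E⊆ H′⊆H)
                   (λ Ee → InT-cong (below-cong τ σ (λ y∈e → τ⇔σ x∈V′ (inV H′ _ Ee y∈e))))
                   (H′-large x x∈V′)
... | no x∉V′ = LargeAt-top (Subgraph.E⊆ H′⊆H)
                  (λ Ee → InT-last (uniform H′ _ Ee) (λ x∈e → x∉V′ (inV H′ _ Ee x∈e))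
                                   (λ y∈e → V′-first x∈V x∉V′ (inV H′ _ Ee y∈e)))
                  (H′-large v v∈V′)

proposition2p6 : ∀ (r n : ℕ) (H : RGraph r n) →
    ∃[ H' ] (Subgraph H' H × Nonempty (V H') × TwoLocallyLarge H') →
    TwoLocallyLarge H
proposition2p6 r n H (H′ , H′⊆H , (v , v∈V′) , τ , (τ-injective , _) , H′-large) =
  let σ , σ-bijective , τ⇔σ , V′-first = ordering-extension V⊆ (v , V⊆ v∈V′) τ τ-injective
  in σ , σ-bijective , large-transfer H′⊆H τ⇔σ V′-first (v , v∈V′) H′-large
  where open Subgraph H′⊆H
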